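{- Let $(G,A)$ be a simple edge-weighted graph and let $(G',A')$ be obtained from it by a finite sequence of collapsing operations. Let $w,u$ be distinct vertices belonging to both $G$ and $G'$. Then the least common multiple, over all paths $p$ from $w$ to $u$, of the gcd of the edge weights of $p$ is the same in $G$ as in $G'$.
   Context: An edge-weighted graph $(G,A)$ is a finite loopless graph (multiple edges allowed unless "simple" is stated) with a weight function $A$ from its edges to positive integers. Collapsing operations: (a) star-clique on a vertex $v$ (of a graph without multiple edges) with neighbours $x_1,\dots,x_d$ and edge $vx_k$ of weight $a_k$: delete $v$ and its incident edges and, for each pair $j<k$, add a new edge between $x_j$ and $x_k$ of weight $\gcd(a_j,a_k)$ (possibly creating multiple edges); (b) edge collapse: replace edges $e_1,\dots,e_r$ ($r\ge2$) joining the same pair of vertices, of weights $a_1,\dots,a_r$, by one edge of weight $\operatorname{lcm}(a_1,\dots,a_r)$. A path from $w$ to $u$ is a sequence of distinct vertices $w=y_0,\dots,y_k=u$ with a choice, for each $t$, of an edge joining $y_{t-1}$ and $y_t$. -}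

module Defs where

open import Data.Nat using (ℕ; _≤_; _≟_)
open import Data.Nat.GCD using (gcd)
open import Data.Nat.LCM using (lcm)
open import Data.Nat.Divisibility using (_∣_)
open import Data.Product using (Σ; _×_; _,_; proj₁; proj₂)
open import Data.Sum using (_⊎_)
open import Data.List using (List; []; _∷_; _++_; map; foldr; length)
open import Data.List.Membership.Propositional using (_∈_)
open import Data.List.Relation.Unary.All using (All)
open import Data.List.Relation.Unary.AllPairs using (AllPairs)
open import Data.List.Relation.Unary.Unique.Propositional using (Unique)
open import Data.List.Relation.Binary.Permutation.Propositional using (_↭_)
open import Relation.Binary.PropositionalEquality using (_≡_; _≢_)
open import Relation.Binary.Construct.Closure.ReflexiveTransitive using (Star)
open import Relation.Nullary using (¬_; yes; no)

Edge : Set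
Edge = ℕ × ℕ × ℕ

end₁ end₂ wt : Edge → ℕ
end₁ (x , _ , _) = x
end₂ (_ , y , _) = y
wt   (_ , _ , a) = a

Joins : Edge → ℕ → ℕ → Set
Joins e x y = (end₁ e ≡ x × end₂ e ≡ y) ⊎ (end₁ e ≡ y × end₂ e ≡ x)

-- Edge-weighted (multi)graph: a finite vertex set (labelled by naturals)
-- and a finite list (multiset) of edges; parallel edges are allowed.
record WGraph : Set where
  constructor graph
  field
    V : List ℕ
    E : List Edge
open WGraph public

WellFormed : WGraph → Set
WellFormed G = Unique (V G) ×
  All (λ e → end₁ e ∈ V G × end₂ e ∈ V G × end₁ e ≢ end₂ e × 1 ≤ wt e) (E G)

NoMultipleEdges : WGraph → Set
NoMultipleEdges G = AllPairs (λ e f → ¬ Joins f (end₁ e) (end₂ e)) (E G)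

Simple : WGraph → Set
Simple G = WellFormed G × NoMultipleEdges G

Incident : ℕ → Edge → Set
Incident v e = end₁ e ≡ v ⊎ end₂ e ≡ v

other : ℕ → Edge → ℕ
other v e with end₁ e ≟ v
... | yes _ = end₂ e
... | no  _ = end₁ e

-- for the edges v x_k (weights a_k) incident to v, in list order, the new
-- edges x_j x_k of weight gcd(a_j, a_k), one for each pair j < k
cliqueEdges : ℕ → List Edge → List Edge
cliqueEdges v [] = []
cliqueEdges v (e ∷ es) =
  map (λ f → (other v e , other v f , gcd (wt e) (wt f))) es ++ cliqueEdges v es

lcmList : List ℕ → ℕ
lcmList = foldr lcm 1

data Collapse : WGraph → WGraph → Set where
  starClique : ∀ {G} (v : ℕ) (V' : List ℕ) (I R : List Edge) →
    NoMultipleEdges G →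
    V G ↭ (v ∷ V') →
    E G ↭ (I ++ R) →
    All (Incident v) I →
    All (λ e → ¬ Incident v e) R →
    Collapse G (graph V' (R ++ cliqueEdges v I))
  edgeCollapse : ∀ {G} (x y : ℕ) (S R : List Edge) →
    E G ↭ (S ++ R) →
    2 ≤ length S →
    All (λ e → Joins e x y) S →
    Collapse G (graph (V G) ((x , y , lcmList (map wt S)) ∷ R))

Collapses : WGraph → WGraph → Set
Collapses = Star Collapse

-- walks with a chosen edge (a membership proof, i.e. a position in the edge
-- list, so parallel edges are distinguished) at each step
data Walk (G : WGraph) : ℕ → ℕ → Set where
  stop : ∀ {w} → Walk G w w
  step : ∀ {w x u} (e : Edge) → e ∈ E G → Joins e w x → Walk G x u → Walk G w u

walkVertices : ∀ {G w u} → Walk G w u → List ℕ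
walkVertices {w = w} stop = w ∷ []
walkVertices {w = w} (step _ _ _ p) = w ∷ walkVertices p

-- gcd of the edge weights (0, the neutral element of gcd, for no edges)
walkGcd : ∀ {G w u} → Walk G w u → ℕ
walkGcd stop = 0
walkGcd (step e _ _ p) = gcd (wt e) (walkGcd p)

Path : WGraph → ℕ → ℕ → Set
Path G w u = Σ (Walk G w u) (λ p → Unique (walkVertices p))

IsPathLcm : WGraph → ℕ → ℕ → ℕ → Set
IsPathLcm G w u L =
  ((p : Path G w u) → walkGcd (proj₁ p) ∣ L) ×
  ((m : ℕ) → ((p : Path G w u) → walkGcd (proj₁ p) ∣ m) → L ∣ m)

module Submission where

-- A walk and the path obtained from it by erasing loops use a subset of its edges, so
-- the gcd of the walk divides that of the path: paths and walks from w to u have the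
-- same common multiples of their gcds, and it suffices to compare walks.
-- A star-clique on v trades a passage x — v — y for the clique edge x y of weight
-- gcd (a_x , a_y) and back, so every walk gcd of either graph divides one of the other.
-- After an edge collapse, a walk crossing the merged edge, of weight lcm (a_1 , … , a_r),
-- has gcd dividing every common multiple of the gcds of its variants through each a_i,
-- since gcd (lcm (a , b) , c) divides lcm (gcd (a , c) , gcd (b , c)).
-- The lcm exists because all path gcds are realised by walks with at most |V| edges,
-- of which there are finitely many.

open import Defs
open import Data.Nat using (ℕ; zero; suc; _*_; _≤_; z≤n; s≤s; _≟_)
open import Data.Nat.Properties using (*-comm; ≤-trans; n≤1+n)
open import Data.Nat.Divisibility
  using (_∣_; ∣-refl; ∣-reflexive; ∣-trans; _∣0; 1∣_; *-pres-∣; *-cancelˡ-∣; module ∣-Reasoning)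
open import Data.Nat.GCD
open import Data.Nat.LCM using (lcm; m∣lcm[m,n]; n∣lcm[m,n]; lcm-least; gcd*lcm)
open import Relation.Binary.PropositionalEquality
open import Data.Product using (Σ; _×_; _,_; proj₁; proj₂)
open import Data.Sum using (_⊎_; inj₁; inj₂; swap)
open import Data.Empty using (⊥-elim)
open import Data.List using (List; []; _∷_; _++_; map; length; concatMap; filter)
open import Data.List.Relation.Unary.Any using (here; there)
open import Data.List.Relation.Unary.All as All using (All; [])
open import Data.List.Relation.Unary.All.Properties using (¬Any⇒All¬)
open import Data.List.Relation.Unary.Unique.Propositional using (Unique; []; _∷_)
open import Data.List.Relation.Binary.Subset.Propositional using (_⊆_)
open import Data.List.Relation.Binary.Permutation.Propositional using (_↭_; ↭-sym; ↭⇒↭ₛ)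
open import Data.List.Relation.Binary.Permutation.Propositional.Properties using (∈-resp-↭)
open import Data.List.Relation.Binary.Permutation.Setoid.Properties (setoid ℕ)
  using (Unique-resp-↭)
open import Data.List.Membership.Propositional using (_∈_; find; lose)
open import Data.List.Membership.Propositional.Properties
  using (∈-++⁺ˡ; ∈-++⁺ʳ; ∈-++⁻; ∈-map⁺; ∈-map⁻; ∈-concatMap⁺; ∈-concatMap⁻; ∈-filter⁺; ∈-filter⁻)
open import Data.List.Membership.DecPropositional _≟_ using (_∈?_)
open import Function.Bundles using (_⇔_; mk⇔; Equivalence)
open import Relation.Binary.Construct.Closure.ReflexiveTransitive using (ε; _◅_)
open import Relation.Nullary using (¬_; Dec; yes; no)
open import Relation.Nullary.Decidable using (_×-dec_; _⊎-dec_)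

gcd-mono-∣ : ∀ {a b c d} → a ∣ b → c ∣ d → gcd a c ∣ gcd b d
gcd-mono-∣ {a} {b} {c} {d} a∣b c∣d =
  gcd-greatest (∣-trans (gcd[m,n]∣m a c) a∣b) (∣-trans (gcd[m,n]∣n a c) c∣d)

gcd-monoʳ-∣ : ∀ a {c d} → c ∣ d → gcd a c ∣ gcd a d
gcd-monoʳ-∣ a = gcd-mono-∣ (∣-refl {a})

gcd[gcd[a,b],c]∣gcd[a,gcd[b,d]] : ∀ a b {c d} → c ∣ d → gcd (gcd a b) c ∣ gcd a (gcd b d)
gcd[gcd[a,b],c]∣gcd[a,gcd[b,d]] a b {d = d} c∣d =
  ∣-trans (gcd-monoʳ-∣ (gcd a b) c∣d) (∣-reflexive (gcd-assoc a b d))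

gcd-leftComm : ∀ a b c → gcd a (gcd b c) ≡ gcd b (gcd a c)
gcd-leftComm a b c = begin
  gcd a (gcd b c) ≡⟨ gcd-assoc a b c ⟨
  gcd (gcd a b) c ≡⟨ cong (λ x → gcd x c) (gcd-comm a b) ⟩
  gcd (gcd b a) c ≡⟨ gcd-assoc b a c ⟩
  gcd b (gcd a c) ∎
  where open ≡-Reasoning

-- Multiplying by h = gcd (gcd a c) (gcd b c) reduces the claim to the identity
-- a · b = gcd a b · lcm a b, used for both pairs (a , b) and (gcd a c , gcd b c).
gcd[lcm[a,b],c]∣lcm[gcd[a,c],gcd[b,c]] : ∀ a b c → gcd (lcm a b) c ∣ lcm (gcd a c) (gcd b c)
gcd[lcm[a,b],c]∣lcm[gcd[a,c],gcd[b,c]] a b c = by-cases (gcd d e) refl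
  where
  d = gcd a c
  e = gcd b c
  g = gcd (lcm a b) c
  by-cases : ∀ h → gcd d e ≡ h → g ∣ lcm d e
  by-cases zero    h≡ = subst (λ x → g ∣ lcm x e) (sym (gcd[m,n]≡0⇒m≡0 {d} {e} h≡)) (g ∣0)
  by-cases h@(suc _) h≡ = *-cancelˡ-∣ h (begin
    h * g                 ∣⟨ gcd-greatest (*-pres-∣ h∣e (gcd[m,n]∣n (lcm a b) c)) h*g∣e*a ⟩
    gcd (e * c) (e * a)   ≡⟨ c*gcd[m,n]≡gcd[cm,cn] e c a ⟨
    e * gcd c a           ≡⟨ cong (e *_) (gcd-comm c a) ⟩
    e * d                 ≡⟨ *-comm e d ⟩
    d * e                 ≡⟨ gcd*lcm d e ⟨
    gcd d e * lcm d e     ≡⟨ cong (_* lcm d e) h≡ ⟩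
    h * lcm d e           ∎)
    where
      open ∣-Reasoning
      h∣d : h ∣ d
      h∣d = subst (_∣ d) h≡ (gcd[m,n]∣m d e)
      h∣e : h ∣ e
      h∣e = subst (_∣ e) h≡ (gcd[m,n]∣n d e)
      h∣a : h ∣ a
      h∣a = ∣-trans h∣d (gcd[m,n]∣m a c)
      h∣gcd[a,b] : h ∣ gcd a b
      h∣gcd[a,b] = gcd-greatest h∣a (∣-trans h∣e (gcd[m,n]∣m b c))
      h*g∣e*a : h * g ∣ e * a
      h*g∣e*a = begin
        h * g                           ∣⟨ gcd-greatest (*-pres-∣ h∣gcd[a,b] (gcd[m,n]∣m (lcm a b) c))
                                                        (*-pres-∣ h∣a (gcd[m,n]∣n (lcm a b) c)) ⟩
        gcd (gcd a b * lcm a b) (a * c) ≡⟨ cong (λ x → gcd x (a * c)) (gcd*lcm a b) ⟩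
        gcd (a * b) (a * c)             ≡⟨ c*gcd[m,n]≡gcd[cm,cn] a b c ⟨
        a * e                           ≡⟨ *-comm a e ⟩
        e * a                           ∎

gcd[lcmList,c]∣ : ∀ c {m} ts → (∀ {t} → t ∈ ts → gcd t c ∣ m) → gcd (lcmList ts) c ∣ m
gcd[lcmList,c]∣ c {m} [] _ = subst (_∣ m) (sym (gcd-zeroˡ c)) (1∣ m)
gcd[lcmList,c]∣ c (t ∷ ts) h =
  ∣-trans (gcd[lcm[a,b],c]∣lcm[gcd[a,c],gcd[b,c]] t (lcmList ts) c)
          (lcm-least (h (here refl)) (gcd[lcmList,c]∣ c ts (λ t∈ → h (there t∈))))

∈⇒∣lcmList : ∀ {t ts} → t ∈ ts → t ∣ lcmList ts
∈⇒∣lcmList {ts = t ∷ ts} (here refl) = m∣lcm[m,n] t (lcmList ts)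
∈⇒∣lcmList {ts = t ∷ ts} (there t∈) = ∣-trans (∈⇒∣lcmList t∈) (n∣lcm[m,n] t (lcmList ts))

lcmList-least : ∀ {m} ts → (∀ {t} → t ∈ ts → t ∣ m) → lcmList ts ∣ m
lcmList-least []       _ = 1∣ _
lcmList-least (t ∷ ts) h = lcm-least (h (here refl)) (lcmList-least ts (λ t∈ → h (there t∈)))

∈⇒removable : ∀ {A : Set} {x : A} {ys} → x ∈ ys →
  Σ (List A) λ zs → length ys ≡ suc (length zs) × (∀ {z} → z ∈ ys → z ≢ x → z ∈ zs)
∈⇒removable {ys = _ ∷ ys} (here refl) = ys , refl , λ where
  (here refl) z≢x → ⊥-elim (z≢x refl)
  (there z∈)  _   → z∈
∈⇒removable {ys = y ∷ _} (there x∈) with ∈⇒removable x∈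
... | zs , len≡ , keep = y ∷ zs , cong suc len≡ , λ where
  (here refl) _   → here refl
  (there z∈)  z≢x → there (keep z∈ z≢x)

Unique∧⊆⇒length≤ : ∀ {A : Set} {xs ys : List A} → Unique xs → xs ⊆ ys → length xs ≤ length ys
Unique∧⊆⇒length≤ {xs = []} _ _ = z≤n
Unique∧⊆⇒length≤ {xs = x ∷ xs} (x∉xs ∷ uxs) xs⊆ys with ∈⇒removable (xs⊆ys (here refl))
... | zs , len≡ , keep rewrite len≡ =
  s≤s (Unique∧⊆⇒length≤ uxs (λ z∈ → keep (xs⊆ys (there z∈)) (λ { refl → All.lookup x∉xs z∈ refl })))

Joins-sym : ∀ {e x y} → Joins e x y → Joins e y x
Joins-sym = swap

Joins-transfer : ∀ {e f a b x y} → Joins e a b → Joins e x y → Joins f x y → Joins f a b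
Joins-transfer {_ , _ , _} (inj₁ (refl , refl)) (inj₁ (refl , refl)) jf = jf
Joins-transfer {_ , _ , _} {f} (inj₁ (refl , refl)) (inj₂ (refl , refl)) jf = Joins-sym {f} jf
Joins-transfer {_ , _ , _} {f} (inj₂ (refl , refl)) (inj₁ (refl , refl)) jf = Joins-sym {f} jf
Joins-transfer {_ , _ , _} (inj₂ (refl , refl)) (inj₂ (refl , refl)) jf = jf

Joins⇒Incident : ∀ {e x y} → Joins e x y → Incident y e
Joins⇒Incident (inj₁ (_ , q)) = inj₂ q
Joins⇒Incident (inj₂ (p , _)) = inj₁ p

Joins⇒∈ends : ∀ {e x y} → Joins e x y → y ∈ end₁ e ∷ end₂ e ∷ []
Joins⇒∈ends (inj₁ (_ , q)) = there (here (sym q))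
Joins⇒∈ends (inj₂ (p , _)) = here (sym p)

Joins? : ∀ e x y → Dec (Joins e x y)
Joins? e x y = (end₁ e ≟ x ×-dec end₂ e ≟ y) ⊎-dec (end₁ e ≟ y ×-dec end₂ e ≟ x)

neighbours : Edge → ℕ → List ℕ
neighbours e x = filter (Joins? e x) (end₁ e ∷ end₂ e ∷ [])

Incident∧Joins⇒≡ : ∀ {v e x y} → Incident v e → Joins e x y → x ≢ v → y ≡ v
Incident∧Joins⇒≡ (inj₁ refl) (inj₁ (refl , _)) x≢v = ⊥-elim (x≢v refl)
Incident∧Joins⇒≡ (inj₁ refl) (inj₂ (refl , _)) _   = refl
Incident∧Joins⇒≡ (inj₂ refl) (inj₁ (_ , refl)) _   = refl
Incident∧Joins⇒≡ (inj₂ refl) (inj₂ (_ , refl)) x≢v = ⊥-elim (x≢v refl)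

Joins-other : ∀ {v} e → Incident v e → Joins e (other v e) v
Joins-other {v} (a , b , _) inc with a ≟ v | inc
... | yes a≡v | _          = inj₂ (a≡v , refl)
... | no  a≢v | inj₁ a≡v   = ⊥-elim (a≢v a≡v)
... | no  _   | inj₂ b≡v   = inj₁ (refl , b≡v)

Joins⇒other≡ : ∀ {v y} e → Joins e v y → y ≢ v → other v e ≡ y
Joins⇒other≡ {v} (a , b , _) j y≢v with a ≟ v | j
... | yes _   | inj₁ (_ , b≡y)   = b≡y
... | yes a≡v | inj₂ (a≡y , _)   = ⊥-elim (y≢v (trans (sym a≡y) a≡v))
... | no  a≢v | inj₁ (a≡v , _)   = ⊥-elim (a≢v a≡v)
... | no  _   | inj₂ (a≡y , _)   = a≡y

∈-cliqueEdges⁺ : ∀ v {I e f} → e ∈ I → f ∈ I → other v e ≢ other v f →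
  Σ Edge λ c → c ∈ cliqueEdges v I × Joins c (other v e) (other v f) × wt c ≡ gcd (wt e) (wt f)
∈-cliqueEdges⁺ v (here refl) (here refl) ≢ = ⊥-elim (≢ refl)
∈-cliqueEdges⁺ v {g ∷ I} (here refl) (there f∈) _ =
  _ , ∈-++⁺ˡ (∈-map⁺ (λ f → other v g , other v f , gcd (wt g) (wt f)) f∈) , inj₁ (refl , refl) , refl
∈-cliqueEdges⁺ v {g ∷ I} {e} (there e∈) (here refl) _ =
  _ , ∈-++⁺ˡ (∈-map⁺ (λ f → other v g , other v f , gcd (wt g) (wt f)) e∈) , inj₂ (refl , refl) ,
  gcd-comm (wt g) (wt e)
∈-cliqueEdges⁺ v {g ∷ I} (there e∈) (there f∈) ≢ with c , c∈ , j , w ← ∈-cliqueEdges⁺ v e∈ f∈ ≢ =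
  c , ∈-++⁺ʳ (map _ I) c∈ , j , w

∈-cliqueEdges⁻ : ∀ v {I c} → c ∈ cliqueEdges v I →
  Σ Edge λ e → Σ Edge λ f → e ∈ I × f ∈ I × c ≡ (other v e , other v f , gcd (wt e) (wt f))
∈-cliqueEdges⁻ v {g ∷ I} c∈ with ∈-++⁻ (map (λ f → other v g , other v f , gcd (wt g) (wt f)) I) c∈
... | inj₁ c∈new with f , f∈ , refl ← ∈-map⁻ (λ f → other v g , other v f , gcd (wt g) (wt f)) c∈new =
  g , f , here refl , there f∈ , refl
... | inj₂ c∈old with e , f , e∈ , f∈ , c≡ ← ∈-cliqueEdges⁻ v c∈old =
  e , f , there e∈ , there f∈ , c≡

walkLength : ∀ {G w u} → Walk G w u → ℕ
walkLength stop           = 0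
walkLength (step _ _ _ p) = suc (walkLength p)

length-walkVertices : ∀ {G w u} (p : Walk G w u) → length (walkVertices p) ≡ suc (walkLength p)
length-walkVertices stop           = refl
length-walkVertices (step _ _ _ p) = cong suc (length-walkVertices p)

WalkGcdsDivide : WGraph → ℕ → ℕ → ℕ → Set
WalkGcdsDivide G w u m = (p : Walk G w u) → walkGcd p ∣ m

PathGcdsDivide : WGraph → ℕ → ℕ → ℕ → Set
PathGcdsDivide G w u m = (p : Path G w u) → walkGcd (proj₁ p) ∣ m

WalkGcdsDivide-pullback : ∀ {G H w u m} →
  ((p : Walk G w u) → Σ (Walk H w u) λ q → walkGcd p ∣ walkGcd q) →
  WalkGcdsDivide H w u m → WalkGcdsDivide G w u m
WalkGcdsDivide-pullback lift divides p = let q , p∣q = lift p in ∣-trans p∣q (divides q)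

module _ {G : WGraph} {u : ℕ} where

  suffixFrom : ∀ {x w} (p : Walk G x u) → w ∈ walkVertices p → Unique (walkVertices p) →
    Σ (Path G w u) λ q → walkGcd p ∣ walkGcd (proj₁ q)
  suffixFrom stop                (here refl) up       = (stop , up) , ∣-refl
  suffixFrom p@(step _ _ _ _)    (here refl) up       = (p , up) , ∣-refl
  suffixFrom (step e _ _ p)      (there w∈)  (_ ∷ up) with q , d ← suffixFrom p w∈ up =
    q , ∣-trans (gcd[m,n]∣n (wt e) (walkGcd p)) d

  loopErase : ∀ {w} (p : Walk G w u) → Σ (Path G w u) λ q → walkGcd p ∣ walkGcd (proj₁ q)
  loopErase stop = (stop , [] ∷ []) , ∣-refl
  loopErase {w} (step e e∈ j p) with (q , uq) , d ← loopErase p | w ∈? walkVertices q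
  ... | yes w∈q = let r , d′ = suffixFrom q w∈q uq in
                  r , ∣-trans (gcd[m,n]∣n (wt e) (walkGcd p)) (∣-trans d d′)
  ... | no  w∉q = (step e e∈ j q , ¬Any⇒All¬ _ w∉q ∷ uq) , gcd-monoʳ-∣ (wt e) d

  PathGcdsDivide⇒WalkGcdsDivide : ∀ {w m} → PathGcdsDivide G w u m → WalkGcdsDivide G w u m
  PathGcdsDivide⇒WalkGcdsDivide divides p = let q , p∣q = loopErase p in ∣-trans p∣q (divides q)

IsPathLcm-transfer : ∀ {G H w u L} → (∀ m → WalkGcdsDivide G w u m ⇔ WalkGcdsDivide H w u m) →
  IsPathLcm G w u L → IsPathLcm H w u L
IsPathLcm-transfer {L = L} same (divides , least) =
  (λ p → Equivalence.to (same L) (PathGcdsDivide⇒WalkGcdsDivide divides) (proj₁ p)) ,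
  (λ m dividesH →
    least m (λ p → Equivalence.from (same m) (PathGcdsDivide⇒WalkGcdsDivide dividesH) (proj₁ p)))

module WalkGcdEnumeration (G : WGraph) (u : ℕ) where

  stopGcds : ℕ → List ℕ
  stopGcds x with x ≟ u
  ... | yes _ = 0 ∷ []
  ... | no  _ = []

  mutual
    walkGcdsWithin : ℕ → ℕ → List ℕ
    walkGcdsWithin zero    x = stopGcds x
    walkGcdsWithin (suc n) x = stopGcds x ++ concatMap (firstEdgeGcds n x) (E G)

    firstEdgeGcds : ℕ → ℕ → Edge → List ℕ
    firstEdgeGcds n x e = concatMap (stepGcds n e) (neighbours e x)

    stepGcds : ℕ → Edge → ℕ → List ℕ
    stepGcds n e y = map (gcd (wt e)) (walkGcdsWithin n y)

  stopGcds-sound : ∀ {t x} → t ∈ stopGcds x → Σ (Walk G x u) λ p → walkGcd p ≡ t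
  stopGcds-sound {x = x} t∈ with x ≟ u | t∈
  ... | yes refl | here refl = stop , refl

  walkGcdsWithin-sound : ∀ n {t x} → t ∈ walkGcdsWithin n x → Σ (Walk G x u) λ p → walkGcd p ≡ t
  walkGcdsWithin-sound zero t∈ = stopGcds-sound t∈
  walkGcdsWithin-sound (suc n) {x = x} t∈ with ∈-++⁻ (stopGcds x) t∈
  ... | inj₁ t∈stop = stopGcds-sound t∈stop
  ... | inj₂ t∈step
    with e , e∈ , t∈e ← find (∈-concatMap⁻ (firstEdgeGcds n x) t∈step)
    with y , y∈ , t∈y ← find (∈-concatMap⁻ (stepGcds n e) {xs = neighbours e x} t∈e)
    with s , s∈ , refl ← ∈-map⁻ (gcd (wt e)) t∈y
    with p , p≡s ← walkGcdsWithin-sound n s∈ =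
    step e e∈ (proj₂ (∈-filter⁻ (Joins? e x) {xs = end₁ e ∷ end₂ e ∷ []} y∈)) p ,
    cong (gcd (wt e)) p≡s

  0∈stopGcds : 0 ∈ stopGcds u
  0∈stopGcds with u ≟ u
  ... | yes _   = here refl
  ... | no  u≢u = ⊥-elim (u≢u refl)

  walkGcdsWithin-complete : ∀ n {x} (p : Walk G x u) → walkLength p ≤ n → walkGcd p ∈ walkGcdsWithin n x
  walkGcdsWithin-complete zero    stop _ = 0∈stopGcds
  walkGcdsWithin-complete (suc n) stop _ = ∈-++⁺ˡ 0∈stopGcds
  walkGcdsWithin-complete (suc n) {x} (step e e∈ j p) (s≤s length≤n) =
    ∈-++⁺ʳ (stopGcds x) (∈-concatMap⁺ (firstEdgeGcds n x) (lose e∈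
      (∈-concatMap⁺ (stepGcds n e) (lose (∈-filter⁺ (Joins? e x) (Joins⇒∈ends {e} j) j)
        (∈-map⁺ (gcd (wt e)) (walkGcdsWithin-complete n p length≤n))))))

module _ {G : WGraph} (wf : WellFormed G) where

  Joins⇒∈V : ∀ {e x y} → e ∈ E G → Joins e x y → y ∈ V G
  Joins⇒∈V e∈ j with All.lookup (proj₂ wf) e∈ | j
  ... | _      , end₂∈ , _ | inj₁ (_ , refl) = end₂∈
  ... | end₁∈  , _         | inj₂ (refl , _) = end₁∈

  walkVertices⊆V : ∀ {x u} → x ∈ V G → (p : Walk G x u) → walkVertices p ⊆ V G
  walkVertices⊆V x∈ stop            (here refl) = x∈
  walkVertices⊆V x∈ (step _ _ _ _)  (here refl) = x∈
  walkVertices⊆V x∈ (step e e∈ j p) (there z∈)  = walkVertices⊆V (Joins⇒∈V {e} e∈ j) p z∈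

  pathLength≤ : ∀ {w u} → w ∈ V G → (p : Path G w u) → walkLength (proj₁ p) ≤ length (V G)
  pathLength≤ w∈ (p , up) = ≤-trans (n≤1+n _)
    (subst (_≤ length (V G)) (length-walkVertices p) (Unique∧⊆⇒length≤ up (walkVertices⊆V w∈ p)))

  pathLcm-exists : ∀ {w} u → w ∈ V G → Σ ℕ (IsPathLcm G w u)
  pathLcm-exists {w} u w∈ = lcmList gcds , divides , least
    where
    open WalkGcdEnumeration G u
    gcds : List ℕ
    gcds = walkGcdsWithin (length (V G)) w
    divides : PathGcdsDivide G w u (lcmList gcds)
    divides p = ∈⇒∣lcmList (walkGcdsWithin-complete (length (V G)) (proj₁ p) (pathLength≤ w∈ p))
    least : ∀ m → PathGcdsDivide G w u m → lcmList gcds ∣ m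
    least m dividesM = lcmList-least gcds λ t∈ →
      let p , p≡t = walkGcdsWithin-sound (length (V G)) t∈ in
      subst (_∣ m) p≡t (PathGcdsDivide⇒WalkGcdsDivide dividesM p)

module StarClique {G : WGraph} (v : ℕ) (V′ : List ℕ) (I R : List Edge) (E↭ : E G ↭ I ++ R)
  (incident : All (Incident v) I) (nonIncident : All (λ e → ¬ Incident v e) R)
  {u : ℕ} (u≢v : u ≢ v) where

  H : WGraph
  H = graph V′ (R ++ cliqueEdges v I)

  splitEdge : ∀ {e} → e ∈ E G → e ∈ I ⊎ e ∈ R
  splitEdge e∈ = ∈-++⁻ I (∈-resp-↭ E↭ e∈)

  I⊆E : I ⊆ E G
  I⊆E e∈ = ∈-resp-↭ (↭-sym E↭) (∈-++⁺ˡ e∈)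

  R⊆E : R ⊆ E G
  R⊆E e∈ = ∈-resp-↭ (↭-sym E↭) (∈-++⁺ʳ I e∈)

  mutual
    liftWalk : ∀ {x} → x ≢ v → (p : Walk G x u) → Σ (Walk H x u) λ q → walkGcd p ∣ walkGcd q
    liftWalk _ stop = stop , ∣-refl
    liftWalk x≢v (step e e∈ j p) with splitEdge e∈
    ... | inj₂ e∈R
      with q , d ← liftWalk (λ { refl → All.lookup nonIncident e∈R (Joins⇒Incident {e} j) }) p =
      step e (∈-++⁺ˡ e∈R) j q , gcd-monoʳ-∣ (wt e) d
    ... | inj₁ e∈I with refl ← Incident∧Joins⇒≡ {e = e} (All.lookup incident e∈I) j x≢v
                   with refl ← Joins⇒other≡ e (Joins-sym {e} j) x≢v =
      liftWalkFromCentre e∈I p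

    -- The walk p continues at v, which it entered along e from other v e.
    liftWalkFromCentre : ∀ {e} → e ∈ I → (p : Walk G v u) →
      Σ (Walk H (other v e) u) λ q → gcd (wt e) (walkGcd p) ∣ walkGcd q
    liftWalkFromCentre _ stop = ⊥-elim (u≢v refl)
    liftWalkFromCentre {e} e∈I (step {x = y} f f∈ j p) with y ≟ v
    ... | yes refl with q , d ← liftWalkFromCentre e∈I p =
      q , ∣-trans (gcd-monoʳ-∣ (wt e) (gcd[m,n]∣n (wt f) (walkGcd p))) d
    ... | no y≢v with other v e ≟ y
    ...   | yes refl with q , d ← liftWalk y≢v p =
      q , ∣-trans (gcd[m,n]∣n (wt e) _) (∣-trans (gcd[m,n]∣n (wt f) (walkGcd p)) d)
    ...   | no ≢y with splitEdge f∈
    ...     | inj₂ f∈R = ⊥-elim (All.lookup nonIncident f∈R (Joins⇒Incident {f} (Joins-sym {f} j)))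
    ...     | inj₁ f∈I with refl ← Joins⇒other≡ f j y≢v
                       with c , c∈ , jc , wc ← ∈-cliqueEdges⁺ v e∈I f∈I ≢y
                       with q , d ← liftWalk y≢v p =
      step c (∈-++⁺ʳ R c∈) jc q , (begin
        gcd (wt e) (gcd (wt f) (walkGcd p)) ≡⟨ gcd-assoc (wt e) (wt f) (walkGcd p) ⟨
        gcd (gcd (wt e) (wt f)) (walkGcd p) ≡⟨ cong (λ k → gcd k (walkGcd p)) wc ⟨
        gcd (wt c) (walkGcd p)              ∣⟨ gcd-monoʳ-∣ (wt c) d ⟩
        gcd (wt c) (walkGcd q)              ∎)
      where open ∣-Reasoning

  viaCentre : ∀ {e f} → e ∈ I → f ∈ I → Walk G (other v f) u → Walk G (other v e) u
  viaCentre {e} {f} e∈I f∈I p =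
    step e (I⊆E e∈I) (Joins-other e (All.lookup incident e∈I))
      (step f (I⊆E f∈I) (Joins-sym {f} (Joins-other f (All.lookup incident f∈I))) p)

  lowerWalk : ∀ {x} (q : Walk H x u) → Σ (Walk G x u) λ p → walkGcd q ∣ walkGcd p
  lowerWalk stop = stop , ∣-refl
  lowerWalk (step c c∈ j q) with p , d ← lowerWalk q | ∈-++⁻ R c∈
  ... | inj₁ c∈R = step c (R⊆E c∈R) j p , gcd-monoʳ-∣ (wt c) d
  ... | inj₂ c∈K with e , f , e∈I , f∈I , refl ← ∈-cliqueEdges⁻ v {I} c∈K | j
  ...   | inj₁ (refl , refl) = viaCentre {e} {f} e∈I f∈I p , gcd[gcd[a,b],c]∣gcd[a,gcd[b,d]] (wt e) (wt f) d
  ...   | inj₂ (refl , refl) =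
    viaCentre {f} {e} f∈I e∈I p ,
    subst (λ k → gcd k (walkGcd q) ∣ gcd (wt f) (gcd (wt e) (walkGcd p))) (gcd-comm (wt f) (wt e))
      (gcd[gcd[a,b],c]∣gcd[a,gcd[b,d]] (wt f) (wt e) d)

module EdgeCollapse {G : WGraph} (x y : ℕ) (S R : List Edge) (E↭ : E G ↭ S ++ R)
  (parallel : All (λ e → Joins e x y) S) {u : ℕ} where

  merged : Edge
  merged = x , y , lcmList (map wt S)

  H : WGraph
  H = graph (V G) (merged ∷ R)

  splitEdge : ∀ {e} → e ∈ E G → e ∈ S ⊎ e ∈ R
  splitEdge e∈ = ∈-++⁻ S (∈-resp-↭ E↭ e∈)

  S⊆E : S ⊆ E G
  S⊆E e∈ = ∈-resp-↭ (↭-sym E↭) (∈-++⁺ˡ e∈)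

  R⊆E : R ⊆ E G
  R⊆E e∈ = ∈-resp-↭ (↭-sym E↭) (∈-++⁺ʳ S e∈)

  liftWalk : ∀ {z} (p : Walk G z u) → Σ (Walk H z u) λ q → walkGcd p ∣ walkGcd q
  liftWalk stop = stop , ∣-refl
  liftWalk (step e e∈ j p) with q , d ← liftWalk p | splitEdge e∈
  ... | inj₁ e∈S =
    step merged (here refl) (Joins-transfer {e} {merged} j (All.lookup parallel e∈S) (inj₁ (refl , refl))) q ,
    gcd-mono-∣ (∈⇒∣lcmList (∈-map⁺ wt e∈S)) d
  ... | inj₂ e∈R = step e (there e∈R) j q , gcd-monoʳ-∣ (wt e) d

  -- Generalised to a gcd k of the edges already traversed, since the merged edge can be
  -- crossed repeatedly and each crossing may be replaced by a different edge of S.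
  gcd-walkGcd∣-lower : ∀ {z} k m (q : Walk H z u) →
    ((p : Walk G z u) → gcd k (walkGcd p) ∣ m) → gcd k (walkGcd q) ∣ m
  gcd-walkGcd∣-lower k m stop divides = divides stop
  gcd-walkGcd∣-lower k m (step c (there c∈R) j q) divides =
    subst (_∣ m) (gcd-assoc k (wt c) (walkGcd q))
      (gcd-walkGcd∣-lower (gcd k (wt c)) m q λ p →
        subst (_∣ m) (sym (gcd-assoc k (wt c) (walkGcd p))) (divides (step c (R⊆E c∈R) j p)))
  gcd-walkGcd∣-lower k m (step c (here refl) j q) divides =
    subst (_∣ m) (gcd-leftComm (lcmList (map wt S)) k (walkGcd q))
      (gcd[lcmList,c]∣ (gcd k (walkGcd q)) (map wt S) λ t∈ → viaParallel (∈-map⁻ wt t∈))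
    where
    viaParallel : ∀ {t} → Σ Edge (λ s → s ∈ S × t ≡ wt s) → gcd t (gcd k (walkGcd q)) ∣ m
    viaParallel (s , s∈ , refl) =
      subst (_∣ m) (trans (gcd-assoc k (wt s) (walkGcd q)) (gcd-leftComm k (wt s) (walkGcd q)))
        (gcd-walkGcd∣-lower (gcd k (wt s)) m q λ p →
          subst (_∣ m) (sym (gcd-assoc k (wt s) (walkGcd p)))
            (divides (step s (S⊆E s∈)
              (Joins-transfer {merged} {s} j (inj₁ (refl , refl)) (All.lookup parallel s∈)) p)))

  WalkGcdsDivide-lower : ∀ {z m} → WalkGcdsDivide G z u m → WalkGcdsDivide H z u m
  WalkGcdsDivide-lower {m = m} divides q =
    subst (_∣ m) (gcd-identityˡ (walkGcd q))
      (gcd-walkGcd∣-lower 0 m q λ p → subst (_∣ m) (sym (gcd-identityˡ (walkGcd p))) (divides p))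

collapse-V⊆ : ∀ {G H} → Collapse G H → V H ⊆ V G
collapse-V⊆ (starClique _ _ _ _ _ V↭ _ _ _) z∈ = ∈-resp-↭ (↭-sym V↭) (there z∈)
collapse-V⊆ (edgeCollapse _ _ _ _ _ _ _)    z∈ = z∈

collapses-V⊆ : ∀ {G H} → Collapses G H → V H ⊆ V G
collapses-V⊆ ε        z∈ = z∈
collapses-V⊆ (c ◅ cs) z∈ = collapse-V⊆ c (collapses-V⊆ cs z∈)

collapse-Unique : ∀ {G H} → Collapse G H → Unique (V G) → Unique (V H)
collapse-Unique (starClique _ _ _ _ _ V↭ _ _ _) uG with _ ∷ uV′ ← Unique-resp-↭ (↭⇒↭ₛ V↭) uG = uV′
collapse-Unique (edgeCollapse _ _ _ _ _ _ _)    uG = uG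

collapse-WalkGcdsDivide : ∀ {G H w u} → Collapse G H → Unique (V G) → w ∈ V H → u ∈ V H →
  ∀ m → WalkGcdsDivide G w u m ⇔ WalkGcdsDivide H w u m
collapse-WalkGcdsDivide (starClique v V′ I R _ V↭ E↭ inc nonInc) uG w∈ u∈ m
  with v∉V′ ∷ _ ← Unique-resp-↭ (↭⇒↭ₛ V↭) uG =
  mk⇔ (WalkGcdsDivide-pullback lowerWalk) (WalkGcdsDivide-pullback (liftWalk (≢v w∈)))
  where
  ≢v : ∀ {z} → z ∈ V′ → z ≢ v
  ≢v z∈ refl = All.lookup v∉V′ z∈ refl
  open StarClique v V′ I R E↭ inc nonInc (≢v u∈)
collapse-WalkGcdsDivide (edgeCollapse x y S R E↭ _ parallel) _ _ _ m =
  mk⇔ WalkGcdsDivide-lower (WalkGcdsDivide-pullback liftWalk)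
  where open EdgeCollapse x y S R E↭ parallel

collapses-IsPathLcm : ∀ {G H w u L} → Collapses G H → Unique (V G) → w ∈ V H → u ∈ V H →
  IsPathLcm G w u L → IsPathLcm H w u L
collapses-IsPathLcm ε        _  _  _  isLcm = isLcm
collapses-IsPathLcm (c ◅ cs) uG w∈ u∈ isLcm =
  collapses-IsPathLcm cs (collapse-Unique c uG) w∈ u∈
    (IsPathLcm-transfer (collapse-WalkGcdsDivide c uG (collapses-V⊆ cs w∈) (collapses-V⊆ cs u∈)) isLcm)

corollary5p3 : (G G' : WGraph) → Simple G → Collapses G G' →
    (w u : ℕ) → w ≢ u → w ∈ V G → u ∈ V G → w ∈ V G' → u ∈ V G' →
    Σ ℕ (λ L → IsPathLcm G w u L × IsPathLcm G' w u L)
corollary5p3 G G' (wf , _) collapses w u _ w∈G _ w∈G' u∈G' =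
  let L , isLcm = pathLcm-exists wf u w∈G in
  L , isLcm , collapses-IsPathLcm collapses (proj₁ wf) w∈G' u∈G' isLcm
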